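{- Let $M=(V,d)$ be a finite metric space with $|V|\geq 3$ such that $\ell^*(M)+\textsc{up}(M)<|V|$, and such that every subspace $(V',d|_{V'})$ with $V'\subsetneq V$ and $|V'|\geq 3$ satisfies $\ell^*+\textsc{up}\geq |V'|$. If $(v,v')$ is a pair of twins of $M$, then there exists $u\in V\setminus\{v,v'\}$ with $d(v,u)\neq 1$.
   Context: For a metric space $M=(V,d)$ and distinct $x,y\in V$, $\overline{xy}^M=\{z\in V: d(x,y)=d(x,z)+d(z,y)\ \text{or}\ d(x,y)=|d(x,z)-d(z,y)|\}$. A line is universal if it equals $V$, and then $\{x,y\}$ is a universal pair. $\ell^*(M)$ is the number of distinct non-universal lines and $\textsc{up}(M)$ the number of universal pairs. A pair of twins of $M$ is a pair $(v,v')$ of distinct points with $d(v,v')\neq 1$ and $d(v,u)=d(v',u)$ for all $u\notin\{v,v'\}$. (The paper calls $M$ a "minimal metric space not satisfying $\ell^*+\textsc{up}\geq |V|$ with at least three points"; the hypotheses above express this minimality with respect to subspaces.) -}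

module Defs where

open import Level using (0ℓ)
open import Data.Nat as ℕ using (ℕ; _<_; _≤_; _+_)
import Data.Nat.Properties as ℕP
open import Data.Fin using (Fin; toℕ)
open import Data.Bool using (Bool; true; false)
open import Data.Vec using (Vec; tabulate)
import Data.Vec.Properties as VecP
import Data.Bool.Properties as BoolP
open import Data.List using (List; length; filter; deduplicate; allFin; cartesianProduct)
open import Data.Product using (_×_; _,_; Σ; ∃; proj₁; proj₂)
open import Data.Sum using (_⊎_)
open import Relation.Nullary using (¬_; Dec; yes; no; does; ¬?)
open import Relation.Binary using (Rel; Tri; tri<; tri≈; tri>; IsStrictTotalOrder)
open import Relation.Binary.PropositionalEquality using (_≡_; _≢_)
open import Algebra.Structures using (IsCommutativeRing)
open import Function using (Injective)

-- The real numbers, axiomatised as a (Dedekind-)complete ordered field.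
-- Any model of these axioms is isomorphic to ℝ, so quantifying over all
-- models is the same as speaking about ℝ.

record RealNumbers : Set₁ where
  infixl 6 _+ℝ_ _-ℝ_
  infixl 7 _*ℝ_
  infix 4 _<ℝ_ _≤ℝ_
  field
    ℝ     : Set
    _+ℝ_  : ℝ → ℝ → ℝ
    _*ℝ_  : ℝ → ℝ → ℝ
    -ℝ_   : ℝ → ℝ
    0ℝ    : ℝ
    1ℝ    : ℝ
    _<ℝ_  : ℝ → ℝ → Set
    isCommutativeRing : IsCommutativeRing _≡_ _+ℝ_ _*ℝ_ -ℝ_ 0ℝ 1ℝ
    0≢1   : 0ℝ ≢ 1ℝ
    inverse : ∀ x → x ≢ 0ℝ → ∃ λ y → x *ℝ y ≡ 1ℝ
    isStrictTotalOrder : IsStrictTotalOrder _≡_ _<ℝ_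
    +-mono-< : ∀ {x y} z → x <ℝ y → x +ℝ z <ℝ y +ℝ z
    *-pos    : ∀ {x y} → 0ℝ <ℝ x → 0ℝ <ℝ y → 0ℝ <ℝ x *ℝ y

  _≤ℝ_ : ℝ → ℝ → Set
  x ≤ℝ y = x <ℝ y ⊎ x ≡ y

  field
    complete : (P : ℝ → Set) → ∃ P → (∃ λ b → ∀ x → P x → x ≤ℝ b) →
               ∃ λ s → (∀ x → P x → x ≤ℝ s) × (∀ b → (∀ x → P x → x ≤ℝ b) → s ≤ℝ b)

  _-ℝ_ : ℝ → ℝ → ℝ
  x -ℝ y = x +ℝ (-ℝ y)

  compare = IsStrictTotalOrder.compare isStrictTotalOrder

  _≟ℝ_ : (x y : ℝ) → Dec (x ≡ y)
  _≟ℝ_ = IsStrictTotalOrder._≟_ isStrictTotalOrder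

  ∣_∣ℝ : ℝ → ℝ
  ∣ x ∣ℝ with compare x 0ℝ
  ... | tri< _ _ _ = -ℝ x
  ... | tri≈ _ _ _ = x
  ... | tri> _ _ _ = x

module _ (R : RealNumbers) where
  open RealNumbers R

  record IsMetric {n : ℕ} (d : Fin n → Fin n → ℝ) : Set where
    field
      nonneg    : ∀ x y → 0ℝ ≤ℝ d x y
      zero⇔eq   : ∀ x y → (d x y ≡ 0ℝ → x ≡ y) × (x ≡ y → d x y ≡ 0ℝ)
      symmetric : ∀ x y → d x y ≡ d y x
      triangle  : ∀ x y z → d x z ≤ℝ d x y +ℝ d y z

  InLine : ∀ {n} → (Fin n → Fin n → ℝ) → Fin n → Fin n → Fin n → Set
  InLine d x y z = (d x y ≡ d x z +ℝ d z y) ⊎ (d x y ≡ ∣ d x z -ℝ d z y ∣ℝ)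

  inLine? : ∀ {n} (d : Fin n → Fin n → ℝ) x y z → Dec (InLine d x y z)
  inLine? d x y z with d x y ≟ℝ (d x z +ℝ d z y)
  ... | yes p = yes (Data.Sum.inj₁ p)
  ... | no ¬p with d x y ≟ℝ ∣ d x z -ℝ d z y ∣ℝ
  ...   | yes q = yes (Data.Sum.inj₂ q)
  ...   | no ¬q = no λ { (Data.Sum.inj₁ p) → ¬p p ; (Data.Sum.inj₂ q) → ¬q q }

  -- the line through x and y, as a subset (characteristic vector) of V
  line : ∀ {n} → (Fin n → Fin n → ℝ) → Fin n → Fin n → Vec Bool n
  line d x y = tabulate (λ z → does (inLine? d x y z))

  universal? : ∀ {n} (d : Fin n → Fin n → ℝ) → (p : Fin n × Fin n) →
               Dec (line d (proj₁ p) (proj₂ p) ≡ tabulate (λ _ → true))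
  universal? d (x , y) = VecP.≡-dec BoolP._≟_ (line d x y) (tabulate (λ _ → true))

  -- unordered pairs {x,y} of distinct points, listed once each (toℕ x < toℕ y)
  pairs : ∀ n → List (Fin n × Fin n)
  pairs n = filter (λ p → toℕ (proj₁ p) ℕP.<? toℕ (proj₂ p))
                   (cartesianProduct (allFin n) (allFin n))

  ℓ* : ∀ {n} → (Fin n → Fin n → ℝ) → ℕ
  ℓ* {n} d = length (deduplicate (VecP.≡-dec BoolP._≟_)
                (Data.List.map (λ p → line d (proj₁ p) (proj₂ p))
                   (filter (λ p → ¬? (universal? d p)) (pairs n))))

  up : ∀ {n} → (Fin n → Fin n → ℝ) → ℕ
  up {n} d = length (filter (universal? d) (pairs n))

  Satisfies : ∀ {n} → (Fin n → Fin n → ℝ) → Set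
  Satisfies {n} d = n ≤ ℓ* d + up d

  Twins : ∀ {n} → (Fin n → Fin n → ℝ) → Fin n → Fin n → Set
  Twins d v v' = v ≢ v' × d v v' ≢ 1ℝ ×
                 (∀ u → u ≢ v → u ≢ v' → d v u ≡ d v' u)

  -- A subspace V' ⊊ V with |V'| = m is given by an injection f : Fin m → Fin n
  -- (m < n), carrying the induced metric d(f i, f j).
  ProperSubspacesSatisfy : ∀ {n} → (Fin n → Fin n → ℝ) → Set
  ProperSubspacesSatisfy {n} d =
    ∀ m (f : Fin m → Fin n) → Injective _≡_ _≡_ f → 3 ≤ m → m < n →
      Satisfies (λ i j → d (f i) (f j))

module Submission where

-- Suppose instead d(v , u) = 1, hence d(v' , u) = 1, for all u in W = V ∖ {v , v'},
-- and let a = d(v , v').  Two facts valid in every metric space decide which of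
-- these points lie on which lines: a point of the line xy as far from x as y is y or
-- its reflection in x, and a point equidistant from x and y lies on xy only as their
-- midpoint.  We then show ℓ* + up ≥ |V|:
--  * a = 2 and W = {u}: the three pairs are universal;
--  * a ≠ 2 and some u₁ in W is at distance 2 from the rest of W: the lines vv', vu₁,
--    v'u₁ and u₁w (w in W ∖ {u₁}) are distinct and not universal, except that u₁w is
--    a universal pair when W ∖ {u₁} = {w};
--  * otherwise delete v': the subspace satisfies the bound by minimality, its lines
--    and universal pairs lift to V, and V gains the pair {v , v'} or the line vv'.

open import Defs
open import Level using (0ℓ)
open import Data.Nat using (ℕ; suc; _≤_; _<_; _+_; s≤s; z≤n)
import Data.Nat.Properties as ℕP
open import Data.Fin using (Fin; toℕ; punchIn; punchOut)
import Data.Fin.Properties as FinP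
open import Data.Bool using (Bool; true)
import Data.Bool.Properties as BoolP
open import Data.Vec using (Vec; tabulate; lookup)
import Data.Vec.Properties as VecP
open import Data.List using (List; []; _∷_; _++_; length; filter; map; allFin; cartesianProduct; deduplicate)
import Data.List.Properties as ListP
open import Data.List.Membership.Propositional using (_∈_; _∉_)
open import Data.List.Membership.Propositional.Properties
import Data.List.Membership.DecPropositional as DecMembership
open import Data.List.Relation.Binary.Subset.Propositional using (_⊆_)
open import Data.List.Relation.Unary.Any as Any using (here; there)
open import Data.List.Relation.Unary.All as All using ([]; _∷_)
import Data.List.Relation.Unary.All.Properties as AllP
open import Data.List.Relation.Unary.Unique.Propositional using (Unique; []; _∷_)
import Data.List.Relation.Unary.Unique.Propositional.Properties as UniqueP
import Data.List.Relation.Unary.Unique.DecPropositional.Properties as UniqueDecP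
import Data.Product.Properties as ProductP
open import Data.Sum using (_⊎_; inj₁; inj₂; [_,_]) renaming (swap to ⊎-swap)
open import Data.Product using (_×_; _,_; ∃; ∃₂; Σ; proj₁; proj₂; swap)
open import Data.Empty using (⊥-elim)
open import Relation.Nullary using (¬_; Dec; yes; no; ¬?; does; _×-dec_; _→-dec_)
open import Relation.Nullary.Decidable using (decidable-stable; dec-true; does-⇔)
open import Relation.Binary using (tri<; tri≈; tri>; IsStrictTotalOrder)
open import Relation.Binary.Definitions using (DecidableEquality)
open import Relation.Binary.PropositionalEquality hiding ([_])
open import Function using (id; _∘_)
open import Function.Bundles using (mk⇔)
open import Algebra.Bundles using (CommutativeRing)
import Algebra.Properties.AbelianGroup as AbelianGroupProperties

module _ {A : Set} (_≟_ : DecidableEquality A) where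

  private
    length-remove : ∀ {x ys} → x ∈ ys → length (filter (λ y → ¬? (y ≟ x)) ys) < length ys
    length-remove {x} {ys} x∈ys =
      ListP.filter-notAll (λ y → ¬? (y ≟ x)) ys (Any.map (λ x≡y y≢x → y≢x (sym x≡y)) x∈ys)

  unique-length-≤ : ∀ {xs ys} → Unique xs → xs ⊆ ys → length xs ≤ length ys
  unique-length-≤ {[]} _ _ = z≤n
  unique-length-≤ {x ∷ xs} {ys} (x∉xs ∷ xs!) xs⊆ys =
    ℕP.≤-trans (s≤s (unique-length-≤ xs! xs⊆ys∖x)) (length-remove (xs⊆ys (here refl)))
    where
    xs⊆ys∖x : xs ⊆ filter (λ y → ¬? (y ≟ x)) ys
    xs⊆ys∖x z∈xs = ∈-filter⁺ (λ y → ¬? (y ≟ x)) (xs⊆ys (there z∈xs))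
                     (λ z≡x → All.lookup x∉xs z∈xs (sym z≡x))

  unique-length-≤-deduplicate : ∀ {xs ys} → Unique xs → xs ⊆ ys → length xs ≤ length (deduplicate _≟_ ys)
  unique-length-≤-deduplicate xs! xs⊆ys = unique-length-≤ xs! (∈-deduplicate⁺ _≟_ ∘ xs⊆ys)

  singleton-or-companion : ∀ {xs} → Unique xs →
    (∃ λ x → xs ≡ x ∷ []) ⊎ (∀ {w} → w ∈ xs → ∃ λ z → z ∈ xs × z ≢ w)
  singleton-or-companion {[]} _ = inj₂ λ ()
  singleton-or-companion {x ∷ []} _ = inj₁ (x , refl)
  singleton-or-companion {x ∷ y ∷ xs} ((x≢y ∷ _) ∷ _) = inj₂ companion
    where
    companion : ∀ {w} → w ∈ x ∷ y ∷ xs → ∃ λ z → z ∈ x ∷ y ∷ xs × z ≢ w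
    companion {w} _ with x ≟ w
    ... | yes x≡w = y , there (here refl) , λ y≡w → x≢y (trans x≡w (sym y≡w))
    ... | no x≢w = x , here refl , x≢w

unique-map-on : ∀ {A B : Set} (f : A → B) {xs} → Unique xs →
  (∀ {x y} → x ∈ xs → y ∈ xs → f x ≡ f y → x ≡ y) → Unique (map f xs)
unique-map-on f {[]} [] _ = []
unique-map-on f {x ∷ xs} (x∉xs ∷ xs!) injective =
  AllP.map⁺ (All.tabulate λ y∈xs fx≡fy → All.lookup x∉xs y∈xs (injective (here refl) (there y∈xs) fx≡fy))
  ∷ unique-map-on f xs! (λ x∈ y∈ → injective (there x∈) (there y∈))

module _ {n : ℕ} where

  open DecMembership (FinP._≟_ {n}) using (_∈?_)

  length-allFin : length (allFin n) ≡ n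
  length-allFin = ListP.length-tabulate (λ i → i)

  unique-length-≤-Fin : ∀ {xs : List (Fin n)} → Unique xs → length xs ≤ n
  unique-length-≤-Fin {xs} xs! =
    subst (length xs ≤_) length-allFin (unique-length-≤ FinP._≟_ xs! (λ {z} _ → ∈-allFin z))

  outside : List (Fin n) → List (Fin n)
  outside xs = filter (λ z → ¬? (z ∈? xs)) (allFin n)

  ∈-outside⁺ : ∀ {xs z} → z ∉ xs → z ∈ outside xs
  ∈-outside⁺ {xs} {z} z∉xs = ∈-filter⁺ (λ z → ¬? (z ∈? xs)) (∈-allFin z) z∉xs

  ∈-outside⁻ : ∀ {xs z} → z ∈ outside xs → z ∉ xs
  ∈-outside⁻ {xs} z∈ = proj₂ (∈-filter⁻ (λ z → ¬? (z ∈? xs)) {xs = allFin n} z∈)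

  outside-unique : ∀ xs → Unique (outside xs)
  outside-unique xs = UniqueP.filter⁺ (λ z → ¬? (z ∈? xs)) (UniqueP.allFin⁺ n)

  count-outside : ∀ xs → n ≤ length xs + length (outside xs)
  count-outside xs =
    subst₂ _≤_ length-allFin (ListP.length-++ xs)
      (unique-length-≤ FinP._≟_ (UniqueP.allFin⁺ n) covered)
    where
    covered : allFin n ⊆ xs ++ outside xs
    covered {z} _ with z ∈? xs
    ... | yes z∈xs = ∈-++⁺ˡ z∈xs
    ... | no z∉xs = ∈-++⁺ʳ xs (∈-outside⁺ z∉xs)

  missing-point : ∀ xs → length xs < n → ∃ λ z → z ∉ xs
  missing-point xs |xs|<n with outside xs in eq
  ... | [] = ⊥-elim (ℕP.<⇒≱ |xs|<n (ℕP.≤-trans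
                 (subst (λ ys → n ≤ length xs + length ys) eq (count-outside xs))
                 (ℕP.≤-reflexive (ℕP.+-identityʳ (length xs)))))
  ... | z ∷ _ = z , ∈-outside⁻ (subst (z ∈_) (sym eq) (here refl))

module OrderedField (R : RealNumbers) where
  open RealNumbers R
  open IsStrictTotalOrder isStrictTotalOrder using (irrefl; asym) renaming (trans to trans<)

  ring : CommutativeRing 0ℓ 0ℓ
  ring = record { isCommutativeRing = isCommutativeRing }

  open CommutativeRing ring using (+-abelianGroup; +-assoc; +-identityˡ; +-identityʳ; -‿inverseˡ; -‿inverseʳ)
  open AbelianGroupProperties +-abelianGroup
    using (⁻¹-involutive; ε⁻¹≈ε; ⁻¹-anti-homo‿-; identityʳ-unique; x≈z//y;
           //-rightDividesˡ; //-rightDividesʳ; \\-leftDividesˡ)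
  open ≡-Reasoning

  2ℝ : ℝ
  2ℝ = 1ℝ +ℝ 1ℝ

  ≤-<-contra : ∀ {x y} → x ≤ℝ y → ¬ (y <ℝ x)
  ≤-<-contra (inj₁ x<y) y<x = asym x<y y<x
  ≤-<-contra (inj₂ refl) x<x = irrefl refl x<x

  +-mono-≤ : ∀ {x y} z → x ≤ℝ y → x +ℝ z ≤ℝ y +ℝ z
  +-mono-≤ z (inj₁ x<y) = inj₁ (+-mono-< z x<y)
  +-mono-≤ z (inj₂ refl) = inj₂ refl

  sign : ∀ x → x ≤ℝ 0ℝ ⊎ 0ℝ ≤ℝ x
  sign x with compare x 0ℝ
  ... | tri< x<0 _ _ = inj₁ (inj₁ x<0)
  ... | tri≈ _ x≡0 _ = inj₁ (inj₂ x≡0)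
  ... | tri> _ _ 0<x = inj₂ (inj₁ 0<x)

  neg-≤0 : ∀ {x} → 0ℝ ≤ℝ x → -ℝ x ≤ℝ 0ℝ
  neg-≤0 {x} (inj₁ 0<x) = inj₁ (subst₂ _<ℝ_ (+-identityˡ (-ℝ x)) (-‿inverseʳ x) (+-mono-< (-ℝ x) 0<x))
  neg-≤0 (inj₂ refl) = inj₂ ε⁻¹≈ε

  neg-≥0 : ∀ {x} → x ≤ℝ 0ℝ → 0ℝ ≤ℝ -ℝ x
  neg-≥0 {x} (inj₁ x<0) = inj₁ (subst₂ _<ℝ_ (-‿inverseʳ x) (+-identityˡ (-ℝ x)) (+-mono-< (-ℝ x) x<0))
  neg-≥0 (inj₂ refl) = inj₂ (sym ε⁻¹≈ε)

  abs-nonneg : ∀ {x} → 0ℝ ≤ℝ x → ∣ x ∣ℝ ≡ x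
  abs-nonneg {x} 0≤x with compare x 0ℝ
  ... | tri< x<0 _ _ = ⊥-elim (≤-<-contra 0≤x x<0)
  ... | tri≈ _ _ _ = refl
  ... | tri> _ _ _ = refl

  abs-nonpos : ∀ {x} → x ≤ℝ 0ℝ → ∣ x ∣ℝ ≡ -ℝ x
  abs-nonpos {x} x≤0 with compare x 0ℝ
  ... | tri< _ _ _ = refl
  ... | tri≈ _ refl _ = sym ε⁻¹≈ε
  ... | tri> _ _ 0<x = ⊥-elim (≤-<-contra x≤0 0<x)

  abs-neg : ∀ x → ∣ -ℝ x ∣ℝ ≡ ∣ x ∣ℝ
  abs-neg x with sign x
  ... | inj₁ x≤0 = trans (abs-nonneg (neg-≥0 x≤0)) (sym (abs-nonpos x≤0))
  ... | inj₂ 0≤x = trans (abs-nonpos (neg-≤0 0≤x)) (trans (⁻¹-involutive x) (sym (abs-nonneg 0≤x)))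

  abs-sub-comm : ∀ x y → ∣ x -ℝ y ∣ℝ ≡ ∣ y -ℝ x ∣ℝ
  abs-sub-comm x y = trans (sym (abs-neg (x -ℝ y))) (cong ∣_∣ℝ (⁻¹-anti-homo‿- x y))

  abs-sub-self : ∀ x → ∣ x -ℝ x ∣ℝ ≡ 0ℝ
  abs-sub-self x = trans (cong ∣_∣ℝ (-‿inverseʳ x)) (abs-nonneg (inj₂ refl))

  abs-≡ : ∀ {x c} → ∣ x ∣ℝ ≡ c → x ≡ c ⊎ x ≡ -ℝ c
  abs-≡ {x} refl with compare x 0ℝ
  ... | tri< _ _ _ = inj₂ (sym (⁻¹-involutive x))
  ... | tri≈ _ _ _ = inj₁ refl
  ... | tri> _ _ _ = inj₁ refl

  +-pos : ∀ {x y} → 0ℝ <ℝ x → 0ℝ <ℝ y → 0ℝ <ℝ x +ℝ y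
  +-pos {x} {y} 0<x 0<y = trans< 0<y (subst (_<ℝ x +ℝ y) (+-identityˡ y) (+-mono-< y 0<x))

  double-≰ : ∀ {c} → 0ℝ <ℝ c → ¬ (c +ℝ c ≤ℝ c)
  double-≰ {c} 0<c 2c≤c =
    ≤-<-contra (subst₂ _≤ℝ_ (//-rightDividesʳ c c) (-‿inverseʳ c) (+-mono-≤ (-ℝ c) 2c≤c)) 0<c

  equal-legs : ∀ {c t} → (c ≡ c +ℝ t) ⊎ (c ≡ ∣ c -ℝ t ∣ℝ) → t ≡ 0ℝ ⊎ t ≡ c +ℝ c
  equal-legs {c} {t} (inj₁ c≡c+t) = inj₁ (identityʳ-unique c t (sym c≡c+t))
  equal-legs {c} {t} (inj₂ c≡∣c-t∣) with abs-≡ (sym c≡∣c-t∣)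
  ... | inj₁ c-t≡c = inj₁ (begin
        t             ≡⟨ ⁻¹-involutive t ⟨
        -ℝ (-ℝ t)     ≡⟨ cong -ℝ_ (identityʳ-unique c (-ℝ t) c-t≡c) ⟩
        -ℝ 0ℝ         ≡⟨ ε⁻¹≈ε ⟩
        0ℝ            ∎)
  ... | inj₂ c-t≡-c = inj₂ (begin
        t                         ≡⟨ \\-leftDividesˡ c t ⟨
        c +ℝ ((-ℝ c) +ℝ t)        ≡⟨ cong (λ s → c +ℝ (s +ℝ t)) c-t≡-c ⟨
        c +ℝ ((c -ℝ t) +ℝ t)      ≡⟨ cong (c +ℝ_) (//-rightDividesˡ t c) ⟩
        c +ℝ c                    ∎)

  reflected-leg : ∀ {c} → 0ℝ ≤ℝ c → c ≡ ∣ c -ℝ (c +ℝ c) ∣ℝ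
  reflected-leg {c} 0≤c = sym (begin
    ∣ c -ℝ (c +ℝ c) ∣ℝ   ≡⟨ cong ∣_∣ℝ c-2c≡-c ⟩
    ∣ -ℝ c ∣ℝ            ≡⟨ abs-neg c ⟩
    ∣ c ∣ℝ               ≡⟨ abs-nonneg 0≤c ⟩
    c                    ∎)
    where
    c-2c≡-c : c -ℝ (c +ℝ c) ≡ -ℝ c
    c-2c≡-c = sym (x≈z//y (-ℝ c) (c +ℝ c) c (begin
      (-ℝ c) +ℝ (c +ℝ c)   ≡⟨ +-assoc (-ℝ c) c c ⟨
      ((-ℝ c) +ℝ c) +ℝ c   ≡⟨ cong (_+ℝ c) (-‿inverseˡ c) ⟩
      0ℝ +ℝ c              ≡⟨ +-identityˡ c ⟩
      c                    ∎))

module LineSets (R : RealNumbers) {n : ℕ} (d : Fin n → Fin n → RealNumbers.ℝ R) where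
  open RealNumbers R

  OnLine : Fin n → Fin n → Fin n → Set
  OnLine = InLine R d

  full : Vec Bool n
  full = tabulate (λ _ → true)

  Universal : Fin n → Fin n → Set
  Universal x y = line R d x y ≡ full

  lookup-line : ∀ x y z → lookup (line R d x y) z ≡ does (inLine? R d x y z)
  lookup-line x y z = VecP.lookup∘tabulate _ z

  ∈line⁺ : ∀ {x y z} → OnLine x y z → lookup (line R d x y) z ≡ true
  ∈line⁺ {x} {y} {z} on = trans (lookup-line x y z) (dec-true (inLine? R d x y z) on)

  ∈line⁻ : ∀ {x y z} → lookup (line R d x y) z ≡ true → OnLine x y z
  ∈line⁻ {x} {y} {z} z∈ with inLine? R d x y z | lookup-line x y z
  ... | yes on | _ = on
  ... | no _ | z∉ with () ← trans (sym z∈) z∉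

  universal-intro : ∀ {x y} → (∀ z → OnLine x y z) → Universal x y
  universal-intro {x} {y} on = VecP.tabulate-cong λ z → dec-true (inLine? R d x y z) (on z)

  universal-elim : ∀ {x y} → Universal x y → ∀ z → OnLine x y z
  universal-elim {x} {y} univ z = ∈line⁻ (trans (cong (λ l → lookup l z) univ) (VecP.lookup∘tabulate _ z))

  missed-point : ∀ {x y z} → ¬ OnLine x y z → ¬ Universal x y
  missed-point {z = z} ¬on univ = ¬on (universal-elim univ z)

  lines-differ : ∀ {x y x' y' z} → OnLine x y z → ¬ OnLine x' y' z → line R d x y ≢ line R d x' y'
  lines-differ {z = z} on ¬on same = ¬on (∈line⁻ (trans (cong (λ l → lookup l z) (sym same)) (∈line⁺ on)))

  ∈-pairs⁺ : ∀ {x y} → toℕ x < toℕ y → (x , y) ∈ pairs R n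
  ∈-pairs⁺ {x} {y} x<y = ∈-filter⁺ (λ p → toℕ (proj₁ p) ℕP.<? toℕ (proj₂ p))
                           (∈-cartesianProduct⁺ (∈-allFin x) (∈-allFin y)) x<y

  ∈-pairs⁻ : ∀ {p} → p ∈ pairs R n → toℕ (proj₁ p) < toℕ (proj₂ p)
  ∈-pairs⁻ p∈ = proj₂ (∈-filter⁻ (λ p → toℕ (proj₁ p) ℕP.<? toℕ (proj₂ p))
                         {xs = cartesianProduct (allFin n) (allFin n)} p∈)

  pairs-unique : Unique (pairs R n)
  pairs-unique = UniqueP.filter⁺ _ (UniqueP.cartesianProduct⁺ (UniqueP.allFin⁺ n) (UniqueP.allFin⁺ n))

  Ends : Fin n × Fin n → Fin n → Set
  Ends p w = w ≡ proj₁ p ⊎ w ≡ proj₂ p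


module MetricSpace (R : RealNumbers) {n : ℕ} (d : Fin n → Fin n → RealNumbers.ℝ R) (M : IsMetric R d) where
  open RealNumbers R
  open OrderedField R
  open CommutativeRing ring using (+-comm; +-identityˡ; +-identityʳ)
  open IsMetric M
  open LineSets R d public

  dist-self : ∀ x → d x x ≡ 0ℝ
  dist-self x = proj₂ (zero⇔eq x x) refl

  dist-0 : ∀ {x y} → d x y ≡ 0ℝ → x ≡ y
  dist-0 {x} {y} = proj₁ (zero⇔eq x y)

  dist-pos : ∀ {x y} → x ≢ y → 0ℝ <ℝ d x y
  dist-pos {x} {y} x≢y with nonneg x y
  ... | inj₁ 0<d = 0<d
  ... | inj₂ 0≡d = ⊥-elim (x≢y (dist-0 (sym 0≡d)))

  onLine-left : ∀ x y → OnLine x y x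
  onLine-left x y = inj₁ (sym (trans (cong (_+ℝ d x y) (dist-self x)) (+-identityˡ (d x y))))

  onLine-right : ∀ x y → OnLine x y y
  onLine-right x y = inj₁ (sym (trans (cong (d x y +ℝ_) (dist-self y)) (+-identityʳ (d x y))))

  onLine-sym : ∀ {x y z} → OnLine x y z → OnLine y x z
  onLine-sym {x} {y} {z} (inj₁ e) = inj₁ (trans (symmetric y x) (trans e
    (trans (+-comm (d x z) (d z y)) (cong₂ _+ℝ_ (symmetric z y) (symmetric x z)))))
  onLine-sym {x} {y} {z} (inj₂ e) = inj₂ (trans (symmetric y x) (trans e
    (trans (abs-sub-comm (d x z) (d z y)) (cong₂ (λ s t → ∣ s -ℝ t ∣ℝ) (symmetric z y) (symmetric x z)))))

  isosceles-on-line : ∀ {x y z} → d x y ≡ d x z → OnLine x y z → z ≡ y ⊎ d z y ≡ d x y +ℝ d x y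
  isosceles-on-line {x} {y} {z} xy≡xz on
    with equal-legs (subst (λ s → (d x y ≡ s +ℝ d z y) ⊎ (d x y ≡ ∣ s -ℝ d z y ∣ℝ)) (sym xy≡xz) on)
  ... | inj₁ zy≡0 = inj₁ (dist-0 zy≡0)
  ... | inj₂ zy≡2xy = inj₂ zy≡2xy

  reflection-on-line : ∀ {x y z} → d x y ≡ d x z → d z y ≡ d x y +ℝ d x y → OnLine x y z
  reflection-on-line {x} {y} {z} xy≡xz zy≡2xy =
    inj₂ (trans (reflected-leg (nonneg x y)) (cong₂ (λ s t → ∣ s -ℝ t ∣ℝ) xy≡xz (sym zy≡2xy)))

  equidistant-on-line : ∀ {x y z} → d z x ≡ d z y → OnLine x y z → x ≡ y ⊎ d x y ≡ d x z +ℝ d z y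
  equidistant-on-line _ (inj₁ midpoint) = inj₂ midpoint
  equidistant-on-line {x} {y} {z} zx≡zy (inj₂ e) = inj₁ (dist-0 (trans e (trans
    (cong (λ s → ∣ s -ℝ d z y ∣ℝ) (trans (symmetric x z) zx≡zy)) (abs-sub-self (d z y)))))

  line-sym : ∀ x y → line R d x y ≡ line R d y x
  line-sym x y = VecP.tabulate-cong λ z →
    does-⇔ (mk⇔ onLine-sym onLine-sym) (inLine? R d x y z) (inLine? R d y x z)

  sortPair : ∀ {x y} → x ≢ y → Σ (Fin n × Fin n) λ p → p ∈ pairs R n × (p ≡ (x , y) ⊎ p ≡ (y , x))
  sortPair {x} {y} x≢y with ℕP.<-cmp (toℕ x) (toℕ y)
  ... | tri< x<y _ _ = (x , y) , ∈-pairs⁺ x<y , inj₁ refl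
  ... | tri≈ _ x≡y _ = ⊥-elim (x≢y (FinP.toℕ-injective x≡y))
  ... | tri> _ _ y<x = (y , x) , ∈-pairs⁺ y<x , inj₂ refl

  sorted-line : ∀ {x y p} → p ≡ (x , y) ⊎ p ≡ (y , x) → line R d (proj₁ p) (proj₂ p) ≡ line R d x y
  sorted-line (inj₁ refl) = refl
  sorted-line {x} {y} (inj₂ refl) = line-sym y x

  NonUniversalLine : Vec Bool n → Set
  NonUniversalLine l = ∃₂ λ x y → x ≢ y × line R d x y ≡ l × ¬ Universal x y

  ℓ*-lower-bound : ∀ {ls} → Unique ls → (∀ {l} → l ∈ ls → NonUniversalLine l) → length ls ≤ ℓ* R d
  ℓ*-lower-bound ls! nonUniversal = unique-length-≤-deduplicate (VecP.≡-dec BoolP._≟_) ls! counted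
    where
    counted : ∀ {l} → l ∈ _ → l ∈ map (λ p → line R d (proj₁ p) (proj₂ p))
                                    (filter (λ p → ¬? (universal? R d p)) (pairs R n))
    counted l∈ with nonUniversal l∈
    ... | x , y , x≢y , refl , ¬univ with sortPair x≢y
    ...   | p , p∈ , same = subst (_∈ _) (sorted-line same)
            (∈-map⁺ _ (∈-filter⁺ (λ p → ¬? (universal? R d p)) p∈
              (λ univ → ¬univ (trans (sym (sorted-line same)) univ))))

  up-lower-bound : ∀ {ps} → Unique ps →
    (∀ {p} → p ∈ ps → p ∈ pairs R n × Universal (proj₁ p) (proj₂ p)) → length ps ≤ up R d
  up-lower-bound ps! universal =
    unique-length-≤ (ProductP.≡-dec FinP._≟_ FinP._≟_) ps!
      (λ p∈ → ∈-filter⁺ (universal? R d) (proj₁ (universal p∈)) (proj₂ (universal p∈)))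

  ⟨_⟩ : ∀ {x y} → x ≢ y → Fin n × Fin n
  ⟨ x≢y ⟩ = proj₁ (sortPair x≢y)

  ⟨⟩-counted : ∀ {x y} (x≢y : x ≢ y) → Universal x y →
    ⟨ x≢y ⟩ ∈ pairs R n × Universal (proj₁ ⟨ x≢y ⟩) (proj₂ ⟨ x≢y ⟩)
  ⟨⟩-counted x≢y univ with sortPair x≢y
  ... | p , p∈ , same = p∈ , trans (sorted-line same) univ

  ⟨⟩-ends : ∀ {x y w} (x≢y : x ≢ y) → Ends (x , y) w → Ends ⟨ x≢y ⟩ w
  ⟨⟩-ends x≢y w∈ with sortPair x≢y
  ... | _ , _ , inj₁ refl = w∈
  ... | _ , _ , inj₂ refl = ⊎-swap w∈

  ⟨⟩-≢ : ∀ {x y x' y' w} (x≢y : x ≢ y) (x'≢y' : x' ≢ y') →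
    Ends (x' , y') w → w ≢ x → w ≢ y → ⟨ x≢y ⟩ ≢ ⟨ x'≢y' ⟩
  ⟨⟩-≢ {x} {y} {w = w} x≢y x'≢y' w∈' w≢x w≢y same with sortPair x≢y | ⟨⟩-ends x'≢y' w∈'
  ... | p , _ , order | w∈p = [ w≢x , w≢y ] (unsort order (subst (λ q → Ends q w) (sym same) w∈p))
    where
    unsort : ∀ {p} → p ≡ (x , y) ⊎ p ≡ (y , x) → Ends p w → Ends (x , y) w
    unsort (inj₁ refl) e = e
    unsort (inj₂ refl) e = ⊎-swap e

-- Comparing a metric space on Fin (suc m) with the subspace obtained by deleting the
-- point p, embedded by ι = punchIn p.  Lines of the subspace are restrictions of lines
-- of the whole space, so non-universal lines of the subspace come from distinct
-- non-universal lines of the space; universal pairs of the subspace stay universal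
-- provided their line also contains p.
module PointDeletion (R : RealNumbers) {m : ℕ} (d : Fin (suc m) → Fin (suc m) → RealNumbers.ℝ R)
                     (M : IsMetric R d) (p : Fin (suc m)) where
  open RealNumbers R
  open MetricSpace R d M
  module Sub = LineSets R (λ i j → d (punchIn p i) (punchIn p j))

  ι : Fin m → Fin (suc m)
  ι = punchIn p

  d' : Fin m → Fin m → ℝ
  d' i j = d (ι i) (ι j)

  restrict : Vec Bool (suc m) → Vec Bool m
  restrict l = tabulate (λ i → lookup l (ι i))

  line-restrict : ∀ i j → line R d' i j ≡ restrict (line R d (ι i) (ι j))
  line-restrict i j = VecP.tabulate-cong λ k →
    trans (does-⇔ (mk⇔ id id) (inLine? R d' i j k) (inLine? R d (ι i) (ι j) (ι k)))
          (sym (lookup-line (ι i) (ι j) (ι k)))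

  restrict-full : restrict full ≡ Sub.full
  restrict-full = VecP.tabulate-cong λ i → VecP.lookup∘tabulate _ (ι i)

  ι-injective : ∀ {i j} → ι i ≡ ι j → i ≡ j
  ι-injective {i} {j} = FinP.punchIn-injective p i j

  ι≢p : ∀ i → ι i ≢ p
  ι≢p = FinP.punchInᵢ≢i p

  ι-distinct : ∀ {i j} → (i , j) ∈ pairs R m → ι i ≢ ι j
  ι-distinct ij∈ ιi≡ιj = ℕP.<⇒≢ (Sub.∈-pairs⁻ ij∈) (cong toℕ (ι-injective ιi≡ιj))

  ι-pairs : ∀ {i j} → (i , j) ∈ pairs R m → (ι i , ι j) ∈ pairs R (suc m)
  ι-pairs {i} {j} ij∈ = ∈-pairs⁺ (ℕP.≤∧≢⇒< (FinP.punchIn-mono-≤ p i j (ℕP.<⇒≤ (Sub.∈-pairs⁻ ij∈)))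
                                           (ι-distinct ij∈ ∘ FinP.toℕ-injective))

  _≟ᵥ_ : ∀ {k} → DecidableEquality (Vec Bool k)
  _≟ᵥ_ = VecP.≡-dec BoolP._≟_

  nonUniversalPairs' : List (Fin m × Fin m)
  nonUniversalPairs' = filter (λ q → ¬? (universal? R d' q)) (pairs R m)

  ∈-nonUniversalPairs'⁻ : ∀ {q} → q ∈ nonUniversalPairs' → q ∈ pairs R m × ¬ Sub.Universal (proj₁ q) (proj₂ q)
  ∈-nonUniversalPairs'⁻ = ∈-filter⁻ (λ q → ¬? (universal? R d' q)) {xs = pairs R m}

  liftedLine : Fin m × Fin m → Vec Bool (suc m)
  liftedLine (i , j) = line R d (ι i) (ι j)

  lifted-nonUniversal : ∀ {q} → q ∈ nonUniversalPairs' → NonUniversalLine (liftedLine q)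
  lifted-nonUniversal {i , j} q∈ with ∈-nonUniversalPairs'⁻ q∈
  ... | ij∈ , ¬univ = ι i , ι j , ι-distinct ij∈ , refl ,
        λ univ → ¬univ (trans (line-restrict i j) (trans (cong restrict univ) restrict-full))

  liftedLines : List (Vec Bool (suc m))
  liftedLines = deduplicate _≟ᵥ_ (map liftedLine nonUniversalPairs')

  ∈-liftedLines⁻ : ∀ {k} → k ∈ liftedLines → ∃ λ q → q ∈ nonUniversalPairs' × k ≡ liftedLine q
  ∈-liftedLines⁻ k∈ = ∈-map⁻ liftedLine (∈-deduplicate⁻ _≟ᵥ_ (map liftedLine nonUniversalPairs') k∈)

  ℓ*'≤liftedLines : ℓ* R d' ≤ length liftedLines
  ℓ*'≤liftedLines = subst (ℓ* R d' ≤_) (ListP.length-map restrict liftedLines)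
    (unique-length-≤ _≟ᵥ_ (UniqueDecP.deduplicate-! _≟ᵥ_ _) restricted)
    where
    restricted : ∀ {l} → l ∈ deduplicate _≟ᵥ_ (map (λ q → line R d' (proj₁ q) (proj₂ q)) nonUniversalPairs') →
                 l ∈ map restrict liftedLines
    restricted l∈ with ∈-map⁻ _ (∈-deduplicate⁻ _≟ᵥ_ _ l∈)
    ... | (i , j) , ij∈ , refl = subst (_∈ map restrict liftedLines) (sym (line-restrict i j))
          (∈-map⁺ restrict (∈-deduplicate⁺ _≟ᵥ_ (∈-map⁺ liftedLine ij∈)))

  ℓ*-deletion : ∀ {ls} → Unique ls → (∀ {l} → l ∈ ls → NonUniversalLine l) →
    (∀ {l} → l ∈ ls → ∀ {i j} → i ≢ j → l ≢ line R d (ι i) (ι j)) → length ls + ℓ* R d' ≤ ℓ* R d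
  ℓ*-deletion {ls} ls! nonUniversal new = ℕP.≤-trans (ℕP.+-monoʳ-≤ (length ls) ℓ*'≤liftedLines)
    (subst (_≤ ℓ* R d) (ListP.length-++ ls)
      (ℓ*-lower-bound (UniqueP.++⁺ ls! (UniqueDecP.deduplicate-! _≟ᵥ_ _) disjoint) all-nonUniversal))
    where
    disjoint : ∀ {l} → ¬ (l ∈ ls × l ∈ liftedLines)
    disjoint (l∈ls , l∈) with ∈-liftedLines⁻ l∈
    ... | (i , j) , ij∈ , refl = new l∈ls (ι-distinct (proj₁ (∈-nonUniversalPairs'⁻ ij∈)) ∘ cong ι) refl

    all-nonUniversal : ∀ {l} → l ∈ ls ++ liftedLines → NonUniversalLine l
    all-nonUniversal l∈ with ∈-++⁻ ls l∈
    ... | inj₁ l∈ls = nonUniversal l∈ls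
    ... | inj₂ l∈ with ∈-liftedLines⁻ l∈
    ...   | q , q∈ , refl = lifted-nonUniversal q∈

  universalPairs' : List (Fin m × Fin m)
  universalPairs' = filter (universal? R d') (pairs R m)

  ιι : Fin m × Fin m → Fin (suc m) × Fin (suc m)
  ιι (i , j) = ι i , ι j

  ιι-injective : ∀ {q r} → ιι q ≡ ιι r → q ≡ r
  ιι-injective e = cong₂ _,_ (ι-injective (cong proj₁ e)) (ι-injective (cong proj₂ e))

  module _ (p-on-lines : ∀ {x y} → x ≢ p → y ≢ p → x ≢ y → (∀ z → z ≢ p → OnLine x y z) → OnLine x y p) where

    lifted-universal : ∀ {i j} → (i , j) ∈ pairs R m → Sub.Universal i j → Universal (ι i) (ι j)
    lifted-universal {i} {j} ij∈ univ = universal-intro on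
      where
      off-p : ∀ z → z ≢ p → OnLine (ι i) (ι j) z
      off-p z z≢p = subst (OnLine (ι i) (ι j)) (FinP.punchIn-punchOut (z≢p ∘ sym))
                      (Sub.universal-elim univ (punchOut (z≢p ∘ sym)))
      on : ∀ z → OnLine (ι i) (ι j) z
      on z with z FinP.≟ p
      ... | yes refl = p-on-lines (ι≢p i) (ι≢p j) (ι-distinct ij∈) off-p
      ... | no z≢p = off-p z z≢p

    up-deletion : ∀ {ps} → Unique ps → (∀ {q} → q ∈ ps → q ∈ pairs R (suc m) × Universal (proj₁ q) (proj₂ q)) →
      (∀ {q} → q ∈ ps → Ends q p) → length ps + up R d' ≤ up R d
    up-deletion {ps} ps! universal p-end =
      subst (_≤ up R d) (trans (ListP.length-++ ps) (cong (length ps +_) (ListP.length-map ιι universalPairs')))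
        (up-lower-bound (UniqueP.++⁺ ps! (UniqueP.map⁺ ιι-injective (UniqueP.filter⁺ (universal? R d') Sub.pairs-unique))
                                     disjoint)
                        all-universal)
      where
      disjoint : ∀ {q} → ¬ (q ∈ ps × q ∈ map ιι universalPairs')
      disjoint (q∈ps , q∈) with ∈-map⁻ ιι q∈
      ... | (i , j) , _ , refl = [ ι≢p i ∘ sym , ι≢p j ∘ sym ] (p-end q∈ps)

      all-universal : ∀ {q} → q ∈ ps ++ map ιι universalPairs' → q ∈ pairs R (suc m) × Universal (proj₁ q) (proj₂ q)
      all-universal q∈ with ∈-++⁻ ps q∈
      ... | inj₁ q∈ps = universal q∈ps
      ... | inj₂ q∈ with ∈-map⁻ ιι q∈
      ...   | (i , j) , ij∈ , refl with ∈-filter⁻ (universal? R d') {xs = pairs R m} ij∈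
      ...     | ij∈pairs , univ = ι-pairs ij∈pairs , lifted-universal ij∈pairs univ

twins-sym : ∀ R {n} {d : Fin n → Fin n → RealNumbers.ℝ R} {v v'} → IsMetric R d →
  Twins R d v v' → Twins R d v' v
twins-sym R {v = v} {v'} M (v≢v' , vv'≢1 , same) =
  (λ v'≡v → v≢v' (sym v'≡v)) , (λ v'v≡1 → vv'≢1 (trans (IsMetric.symmetric M v v') v'v≡1)) ,
  (λ u u≢v' u≢v → sym (same u u≢v u≢v'))

-- The geometry forced when (v , v') are twins and every other point is at distance 1
-- from v (hence also from v'): with W = V ∖ {v , v'} and a = d(v , v'), membership of
-- a point in a line through two of v, v' and the points of W is decided by the
-- distances 1, 2 and a alone.
module UnitTwinGeometry (R : RealNumbers) {n : ℕ} (d : Fin n → Fin n → RealNumbers.ℝ R) (M : IsMetric R d)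
  (v v' : Fin n) (twins : Twins R d v v') (unit : ∀ u → u ≢ v → u ≢ v' → d v u ≡ RealNumbers.1ℝ R) where
  open RealNumbers R
  open OrderedField R
  open IsMetric M
  open MetricSpace R d M

  InW : Fin n → Set
  InW u = u ≢ v × u ≢ v'

  a : ℝ
  a = d v v'

  v≢v' : v ≢ v'
  v≢v' = proj₁ twins

  dist-v : ∀ {u} → InW u → d v u ≡ 1ℝ
  dist-v (u≢v , u≢v') = unit _ u≢v u≢v'

  dist-v' : ∀ {u} → InW u → d v' u ≡ 1ℝ
  dist-v' {u} u∈W@(u≢v , u≢v') = trans (sym (proj₂ (proj₂ twins) u u≢v u≢v')) (dist-v u∈W)

  dist-v-sym : ∀ {u} → InW u → d u v ≡ 1ℝ
  dist-v-sym {u} u∈W = trans (symmetric u v) (dist-v u∈W)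

  dist-v'-sym : ∀ {u} → InW u → d u v' ≡ 1ℝ
  dist-v'-sym {u} u∈W = trans (symmetric u v') (dist-v' u∈W)

  spoke-far : ∀ {u w} → InW u → InW w → w ≢ u → OnLine v u w → d u w ≡ 2ℝ
  spoke-far {u} {w} u∈W w∈W w≢u on
    with isosceles-on-line (trans (dist-v u∈W) (sym (dist-v w∈W))) on
  ... | inj₁ w≡u = ⊥-elim (w≢u w≡u)
  ... | inj₂ wu≡2 = trans (symmetric u w) (trans wu≡2 (cong₂ _+ℝ_ (dist-v u∈W) (dist-v u∈W)))

  spoke-twin : ∀ {u} → InW u → OnLine v u v' → a ≡ 2ℝ
  spoke-twin {u} u∈W on
    with isosceles-on-line (trans (dist-v-sym u∈W) (sym (dist-v'-sym u∈W))) (onLine-sym on)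
  ... | inj₁ v'≡v = ⊥-elim (v≢v' (sym v'≡v))
  ... | inj₂ v'v≡2 = trans (symmetric v v') (trans v'v≡2 (cong₂ _+ℝ_ (dist-v-sym u∈W) (dist-v-sym u∈W)))

  spoke-twin⁻ : ∀ {u} → InW u → a ≡ 2ℝ → OnLine v u v'
  spoke-twin⁻ {u} u∈W a≡2 = onLine-sym (reflection-on-line
    (trans (dist-v-sym u∈W) (sym (dist-v'-sym u∈W)))
    (trans (symmetric v' v) (trans a≡2 (sym (cong₂ _+ℝ_ (dist-v-sym u∈W) (dist-v-sym u∈W))))))

  twin-line : ∀ {w} → InW w → OnLine v v' w → a ≡ 2ℝ
  twin-line {w} w∈W on with equidistant-on-line (trans (dist-v-sym w∈W) (sym (dist-v'-sym w∈W))) on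
  ... | inj₁ v≡v' = ⊥-elim (v≢v' v≡v')
  ... | inj₂ a≡vw+wv' = trans a≡vw+wv' (cong₂ _+ℝ_ (dist-v w∈W) (dist-v'-sym w∈W))

  twin-line⁻ : ∀ {w} → InW w → a ≡ 2ℝ → OnLine v v' w
  twin-line⁻ {w} w∈W a≡2 = inj₁ (trans a≡2 (sym (cong₂ _+ℝ_ (dist-v w∈W) (dist-v'-sym w∈W))))

  -- Seen from W the twins are indistinguishable: a line through two points of W
  -- containing v also contains v'.
  twin-transfer : ∀ {x y} → InW x → InW y → OnLine x y v → OnLine x y v'
  twin-transfer {x} {y} x∈W y∈W = subst₂ (λ s t → (d x y ≡ s +ℝ t) ⊎ (d x y ≡ ∣ s -ℝ t ∣ℝ))
    (trans (dist-v-sym x∈W) (sym (dist-v'-sym x∈W))) (trans (dist-v y∈W) (sym (dist-v' y∈W)))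

  far-line-twin : ∀ {u w} → InW u → InW w → d u w ≡ 2ℝ → OnLine u w v
  far-line-twin u∈W w∈W uw≡2 = inj₁ (trans uw≡2 (sym (cong₂ _+ℝ_ (dist-v-sym u∈W) (dist-v w∈W))))

  -- If z ≠ w in W are both at distance 2 from u, then z is not on the line uw:
  -- otherwise d(z , w) = 4, while d(z , w) ≤ d(z , v) + d(v , w) = 2.
  far-line-excludes : ∀ {u w z} → InW z → InW w → z ≢ w → d u z ≡ 2ℝ → d u w ≡ 2ℝ → ¬ OnLine u w z
  far-line-excludes {u} {w} {z} z∈W w∈W z≢w uz≡2 uw≡2 on
    with isosceles-on-line (trans uw≡2 (sym uz≡2)) on
  ... | inj₁ z≡w = z≢w z≡w
  ... | inj₂ zw≡4 = double-≰ 0<2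
        (subst₂ _≤ℝ_ (trans zw≡4 (cong₂ _+ℝ_ uw≡2 uw≡2)) (cong₂ _+ℝ_ (dist-v-sym z∈W) (dist-v w∈W))
                     (triangle z v w))
    where
    0<1 : 0ℝ <ℝ 1ℝ
    0<1 = subst (0ℝ <ℝ_) (dist-v w∈W) (dist-pos (λ v≡w → proj₁ w∈W (sym v≡w)))
    0<2 : 0ℝ <ℝ 2ℝ
    0<2 = +-pos 0<1 0<1

  twin-pair-universal : a ≡ 2ℝ → Universal v v'
  twin-pair-universal a≡2 = universal-intro on
    where
    on : ∀ z → OnLine v v' z
    on z with z FinP.≟ v | z FinP.≟ v'
    ... | yes refl | _ = onLine-left v v'
    ... | no _ | yes refl = onLine-right v v'
    ... | no z≢v | no z≢v' = twin-line⁻ (z≢v , z≢v') a≡2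

  lonely-spoke-universal : ∀ {u} → a ≡ 2ℝ → InW u → (∀ {w} → InW w → w ≡ u) → Universal v u
  lonely-spoke-universal {u} a≡2 u∈W only-u = universal-intro on
    where
    on : ∀ z → OnLine v u z
    on z with z FinP.≟ v | z FinP.≟ v'
    ... | yes refl | _ = onLine-left v u
    ... | no _ | yes refl = spoke-twin⁻ u∈W a≡2
    ... | no z≢v | no z≢v' = subst (OnLine v u) (sym (only-u (z≢v , z≢v'))) (onLine-right v u)

-- The cases a = 2 with |W| = 1, and a ≠ 2 with a hub, are counted
-- directly here; otherwise v' lies on every line containing all other points, which
-- is what deleting v' requires.
module UnitTwinCounting (R : RealNumbers) {n : ℕ} (d : Fin n → Fin n → RealNumbers.ℝ R) (M : IsMetric R d)
  (v v' : Fin n) (twins : Twins R d v v') (unit : ∀ u → u ≢ v → u ≢ v' → d v u ≡ RealNumbers.1ℝ R) where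
  open RealNumbers R
  open OrderedField R using (2ℝ)
  open IsMetric M using (symmetric)
  open MetricSpace R d M
  open UnitTwinGeometry R d M v v' twins unit
  module Swapped = UnitTwinGeometry R d M v' v (twins-sym R M twins) (λ u u≢v' u≢v → dist-v' (u≢v , u≢v'))

  Hub : Fin n → Set
  Hub u = ∀ w → InW w → w ≢ u → d u w ≡ 2ℝ

  NoHub : Set
  NoHub = ¬ (∃ λ u → InW u × Hub u)

  spoke-on-twin : a ≡ 2ℝ ⊎ NoHub → ∀ {u} → InW u → (∀ z → z ≢ v' → OnLine v u z) → OnLine v u v'
  spoke-on-twin (inj₁ a≡2) u∈W _ = spoke-twin⁻ u∈W a≡2
  spoke-on-twin (inj₂ noHub) {u} u∈W on =
    ⊥-elim (noHub (u , u∈W , λ w w∈W w≢u → spoke-far u∈W w∈W w≢u (on w (proj₂ w∈W))))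

  twin-on-line : a ≡ 2ℝ ⊎ NoHub → ∀ {x y} → x ≢ v' → y ≢ v' → x ≢ y →
    (∀ z → z ≢ v' → OnLine x y z) → OnLine x y v'
  twin-on-line case {x} {y} x≢v' y≢v' x≢y on with x FinP.≟ v | y FinP.≟ v
  ... | yes refl | yes refl = ⊥-elim (x≢y refl)
  ... | yes refl | no y≢v = spoke-on-twin case (y≢v , y≢v') on
  ... | no x≢v | yes refl = onLine-sym (spoke-on-twin case (x≢v , x≢v') (λ z z≢v' → onLine-sym (on z z≢v')))
  ... | no x≢v | no y≢v = twin-transfer (x≢v , x≢v') (y≢v , y≢v') (on v v≢v')

  three-universal-pairs : ∀ {u} → a ≡ 2ℝ → InW u → (∀ {w} → InW w → w ≡ u) → 3 ≤ up R d
  three-universal-pairs {u} a≡2 u∈W@(u≢v , u≢v') only-u =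
    up-lower-bound {ps = ⟨ v≢v' ⟩ ∷ ⟨ v≢u ⟩ ∷ ⟨ v'≢u ⟩ ∷ []}
      ((⟨⟩-≢ v≢v' v≢u (inj₂ refl) u≢v u≢v' ∷ ⟨⟩-≢ v≢v' v'≢u (inj₂ refl) u≢v u≢v' ∷ [])
       ∷ (⟨⟩-≢ v≢u v'≢u (inj₁ refl) (≢-sym v≢v') v'≢u ∷ []) ∷ [] ∷ [])
      λ { (here refl) → ⟨⟩-counted v≢v' (twin-pair-universal a≡2)
        ; (there (here refl)) → ⟨⟩-counted v≢u (lonely-spoke-universal a≡2 u∈W only-u)
        ; (there (there (here refl))) → ⟨⟩-counted v'≢u
            (Swapped.lonely-spoke-universal (trans (symmetric v' v) a≡2) (swap u∈W) (only-u ∘ swap)) }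
    where
    v≢u = ≢-sym u≢v
    v'≢u = ≢-sym u≢v'

  -- With W' = W ∖ {u₁}, the lines
  -- vv', vu₁, v'u₁ and u₁w (w ∈ W') are pairwise distinct; the first three are never
  -- universal, and a line u₁w is universal only when W' = {w}.
  module HubCount (a≢2 : a ≢ 2ℝ) {u₁ : Fin n} (u₁∈W : InW u₁) (hub : Hub u₁) where

    W' : List (Fin n)
    W' = outside (v ∷ v' ∷ u₁ ∷ [])

    ∈W'⁻ : ∀ {w} → w ∈ W' → InW w × w ≢ u₁
    ∈W'⁻ w∈ = (w∉ ∘ here , w∉ ∘ there ∘ here) , w∉ ∘ there ∘ there ∘ here
      where w∉ = ∈-outside⁻ w∈

    ∈W'⁺ : ∀ {w} → InW w → w ≢ u₁ → w ∈ W'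
    ∈W'⁺ (w≢v , w≢v') w≢u₁ = ∈-outside⁺ λ
      { (here w≡v) → w≢v w≡v
      ; (there (here w≡v')) → w≢v' w≡v'
      ; (there (there (here w≡u₁))) → w≢u₁ w≡u₁ }

    hub-far : ∀ {w} → w ∈ W' → d u₁ w ≡ 2ℝ
    hub-far w∈ = hub _ (proj₁ (∈W'⁻ w∈)) (proj₂ (∈W'⁻ w∈))

    u₁≢W' : ∀ {w} → w ∈ W' → u₁ ≢ w
    u₁≢W' w∈ u₁≡w = proj₂ (∈W'⁻ w∈) (sym u₁≡w)

    sides : List (Vec Bool n)
    sides = line R d v v' ∷ line R d v u₁ ∷ line R d v' u₁ ∷ []

    spokes : List (Vec Bool n)
    spokes = map (line R d u₁) W'

    u₁∉vv' : ¬ OnLine v v' u₁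
    u₁∉vv' on = a≢2 (twin-line u₁∈W on)

    v'∉vu₁ : ¬ OnLine v u₁ v'
    v'∉vu₁ on = a≢2 (spoke-twin u₁∈W on)

    v∉v'u₁ : ¬ OnLine v' u₁ v
    v∉v'u₁ on = a≢2 (trans (symmetric v v') (Swapped.spoke-twin (swap u₁∈W) on))

    sides-unique : Unique sides
    sides-unique =
      ((λ e → lines-differ (onLine-right v u₁) u₁∉vv' (sym e))
       ∷ (λ e → lines-differ (onLine-right v' u₁) u₁∉vv' (sym e)) ∷ [])
      ∷ ((λ e → lines-differ (onLine-left v u₁) v∉v'u₁ e) ∷ []) ∷ [] ∷ []

    sides-nonUniversal : ∀ {l} → l ∈ sides → NonUniversalLine l
    sides-nonUniversal (here refl) = v , v' , v≢v' , refl , missed-point u₁∉vv'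
    sides-nonUniversal (there (here refl)) = v , u₁ , ≢-sym (proj₁ u₁∈W) , refl , missed-point v'∉vu₁
    sides-nonUniversal (there (there (here refl))) = v' , u₁ , ≢-sym (proj₂ u₁∈W) , refl , missed-point v∉v'u₁

    spoke-through : ∀ {w} → w ∈ W' → OnLine u₁ w v × OnLine u₁ w v'
    spoke-through w∈ =
      far-line-twin u₁∈W w∈W (hub-far w∈) , Swapped.far-line-twin (swap u₁∈W) (swap w∈W) (hub-far w∈)
      where w∈W = proj₁ (∈W'⁻ w∈)

    sides-spokes-disjoint : ∀ {l} → ¬ (l ∈ sides × l ∈ spokes)
    sides-spokes-disjoint (l∈t , l∈s) with ∈-map⁻ (line R d u₁) l∈s
    ... | w , w∈ , refl with l∈t
    ...   | here same = lines-differ (onLine-left u₁ w) u₁∉vv' same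
    ...   | there (here same) = lines-differ (proj₂ (spoke-through w∈)) v'∉vu₁ same
    ...   | there (there (here same)) = lines-differ (proj₁ (spoke-through w∈)) v∉v'u₁ same

    spokes-unique : Unique spokes
    spokes-unique = unique-map-on (line R d u₁) (outside-unique _) λ {w} {z} w∈ z∈ same →
      decidable-stable (w FinP.≟ z) λ w≢z → lines-differ (onLine-right u₁ z)
        (far-line-excludes (proj₁ (∈W'⁻ z∈)) (proj₁ (∈W'⁻ w∈)) (≢-sym w≢z) (hub-far z∈) (hub-far w∈))
        (sym same)

    spoke-nonUniversal : (∀ {w} → w ∈ W' → ∃ λ z → z ∈ W' × z ≢ w) → ∀ {l} → l ∈ spokes → NonUniversalLine l
    spoke-nonUniversal companion l∈ with ∈-map⁻ (line R d u₁) l∈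
    ... | w , w∈ , refl with companion w∈
    ...   | z , z∈ , z≢w = u₁ , w , u₁≢W' w∈ , refl ,
            missed-point (far-line-excludes (proj₁ (∈W'⁻ z∈)) (proj₁ (∈W'⁻ w∈)) z≢w (hub-far z∈) (hub-far w∈))

    lonely-spoke : ∀ {u₂} → W' ≡ u₂ ∷ [] → Universal u₁ u₂
    lonely-spoke {u₂} W'≡[u₂] = universal-intro on
      where
      u₂∈ : u₂ ∈ W'
      u₂∈ = subst (u₂ ∈_) (sym W'≡[u₂]) (here refl)
      on : ∀ z → OnLine u₁ u₂ z
      on z with z FinP.≟ v | z FinP.≟ v' | z FinP.≟ u₁
      ... | yes refl | _ | _ = proj₁ (spoke-through u₂∈)
      ... | no _ | yes refl | _ = proj₂ (spoke-through u₂∈)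
      ... | no _ | no _ | yes refl = onLine-left u₁ u₂
      ... | no z≢v | no z≢v' | no z≢u₁ with subst (z ∈_) W'≡[u₂] (∈W'⁺ (z≢v , z≢v') z≢u₁)
      ...   | here refl = onLine-right u₁ u₂

    hub-count : n ≤ ℓ* R d + up R d
    hub-count with singleton-or-companion FinP._≟_ (outside-unique (v ∷ v' ∷ u₁ ∷ []))
    ... | inj₁ (u₂ , W'≡[u₂]) = begin
      n                     ≤⟨ count-outside (v ∷ v' ∷ u₁ ∷ []) ⟩
      3 + length W'         ≡⟨ cong (λ ws → 3 + length ws) W'≡[u₂] ⟩
      3 + 1                 ≤⟨ ℕP.+-mono-≤ (ℓ*-lower-bound sides-unique sides-nonUniversal)
                                (up-lower-bound ([] ∷ []) λ { (here refl) →
                                   ⟨⟩-counted u₁≢u₂ (lonely-spoke W'≡[u₂]) }) ⟩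
      ℓ* R d + up R d       ∎
      where
      open ℕP.≤-Reasoning
      u₁≢u₂ : u₁ ≢ u₂
      u₁≢u₂ = u₁≢W' (subst (u₂ ∈_) (sym W'≡[u₂]) (here refl))
    ... | inj₂ companion = begin
      n                          ≤⟨ count-outside (v ∷ v' ∷ u₁ ∷ []) ⟩
      3 + length W'              ≡⟨ cong (3 +_) (ListP.length-map (line R d u₁) W') ⟨
      length (sides ++ spokes)   ≤⟨ ℓ*-lower-bound (UniqueP.++⁺ sides-unique spokes-unique sides-spokes-disjoint)
                                                   nonUniversal ⟩
      ℓ* R d                     ≤⟨ ℕP.m≤m+n (ℓ* R d) (up R d) ⟩
      ℓ* R d + up R d            ∎
      where
      open ℕP.≤-Reasoning
      nonUniversal : ∀ {l} → l ∈ sides ++ spokes → NonUniversalLine l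
      nonUniversal l∈ with ∈-++⁻ sides l∈
      ... | inj₁ l∈t = sides-nonUniversal l∈t
      ... | inj₂ l∈s = spoke-nonUniversal companion l∈s

-- Deleting v' leaves a subspace which, by minimality, satisfies ℓ* + up ≥ |V| - 1;
-- in the two remaining cases deleting v' loses a universal pair or a line.
module UnitTwinDeletion (R : RealNumbers) {m : ℕ} (d : Fin (suc m) → Fin (suc m) → RealNumbers.ℝ R)
  (M : IsMetric R d) (v v' : Fin (suc m)) (twins : Twins R d v v')
  (unit : ∀ u → u ≢ v → u ≢ v' → d v u ≡ RealNumbers.1ℝ R) where
  open RealNumbers R
  open OrderedField R using (2ℝ)
  open MetricSpace R d M
  open UnitTwinGeometry R d M v v' twins unit
  open UnitTwinCounting R d M v v' twins unit
  open PointDeletion R d M v'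

  twin-distance-2 : a ≡ 2ℝ → Satisfies R d' → suc m ≤ ℓ* R d + up R d
  twin-distance-2 a≡2 sat = begin
    suc m                          ≤⟨ s≤s sat ⟩
    suc (ℓ* R d' + up R d')        ≡⟨ ℕP.+-suc (ℓ* R d') (up R d') ⟨
    ℓ* R d' + suc (up R d')        ≤⟨ ℕP.+-mono-≤ (ℓ*-deletion [] (λ ()) (λ ()))
                                        (up-deletion (twin-on-line (inj₁ a≡2)) ([] ∷ []) twin-pair twin-pair-end) ⟩
    ℓ* R d + up R d                ∎
    where
    open ℕP.≤-Reasoning
    twin-pair : ∀ {q} → q ∈ ⟨ v≢v' ⟩ ∷ [] → q ∈ pairs R (suc m) × Universal (proj₁ q) (proj₂ q)
    twin-pair (here refl) = ⟨⟩-counted v≢v' (twin-pair-universal a≡2)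
    twin-pair-end : ∀ {q} → q ∈ ⟨ v≢v' ⟩ ∷ [] → Ends q v'
    twin-pair-end (here refl) = ⟨⟩-ends v≢v' (inj₂ refl)

  no-hub : a ≢ 2ℝ → NoHub → ∀ {u} → InW u → Satisfies R d' → suc m ≤ ℓ* R d + up R d
  no-hub a≢2 noHub {u} u∈W sat = ℕP.≤-trans (s≤s sat)
    (ℕP.+-mono-≤ (ℓ*-deletion ([] ∷ []) twin-line-nonUniversal twin-line-new)
                 (up-deletion (twin-on-line (inj₂ noHub)) [] (λ ()) (λ ())))
    where
    off-twin-line : ∀ {w} → InW w → ¬ OnLine v v' w
    off-twin-line w∈W on = a≢2 (twin-line w∈W on)

    twin-line-nonUniversal : ∀ {l} → l ∈ line R d v v' ∷ [] → NonUniversalLine l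
    twin-line-nonUniversal (here refl) = v , v' , v≢v' , refl , missed-point (off-twin-line u∈W)

    -- a line through two distinct points other than v' passes through a point of W
    twin-line-new : ∀ {l} → l ∈ line R d v v' ∷ [] → ∀ {i j} → i ≢ j → l ≢ line R d (ι i) (ι j)
    twin-line-new (here refl) {i} {j} i≢j same with ι i FinP.≟ v
    ... | no ιi≢v = lines-differ (onLine-left (ι i) (ι j)) (off-twin-line (ιi≢v , ι≢p i)) (sym same)
    ... | yes ιi≡v = lines-differ (onLine-right (ι i) (ι j)) (off-twin-line (ιj≢v , ι≢p j)) (sym same)
      where
      ιj≢v : ι j ≢ v
      ιj≢v ιj≡v = i≢j (ι-injective (trans ιi≡v (sym ιj≡v)))

unit-twins-satisfy : (R : RealNumbers) {m : ℕ} (d : Fin (suc m) → Fin (suc m) → RealNumbers.ℝ R) →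
  IsMetric R d → 3 ≤ suc m → ProperSubspacesSatisfy R d →
  (v v' : Fin (suc m)) → Twins R d v v' → (∀ u → u ≢ v → u ≢ v' → d v u ≡ RealNumbers.1ℝ R) →
  Satisfies R d
unit-twins-satisfy R {m} d M 3≤n minimal v v' twins unit = satisfies
  where
  open RealNumbers R
  open OrderedField R using (2ℝ)
  open MetricSpace R d M
  open UnitTwinGeometry R d M v v' twins unit
  open UnitTwinCounting R d M v v' twins unit
  open UnitTwinDeletion R d M v v' twins unit
  open PointDeletion R d M v' using (d'; ι-injective)

  someW : ∃ InW
  someW with missing-point (v ∷ v' ∷ []) 3≤n
  ... | u , u∉ = u , u∉ ∘ here , u∉ ∘ there ∘ here

  u : Fin (suc m)
  u = proj₁ someW

  u∈W : InW u
  u∈W = proj₂ someW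

  only-u : m ≡ 2 → ∀ {w} → InW w → w ≡ u
  only-u m≡2 {w} (w≢v , w≢v') = decidable-stable (w FinP.≟ u) λ w≢u →
    ℕP.<⇒≱ (ℕP.≤-reflexive (cong (λ k → suc (suc k)) m≡2)) (unique-length-≤-Fin {xs = v ∷ v' ∷ u ∷ w ∷ []}
      ((v≢v' ∷ ≢-sym (proj₁ u∈W) ∷ ≢-sym w≢v ∷ [])
       ∷ (≢-sym (proj₂ u∈W) ∷ ≢-sym w≢v' ∷ []) ∷ (≢-sym w≢u ∷ []) ∷ [] ∷ []))

  subspace-satisfies : m ≢ 2 → Satisfies R d'
  subspace-satisfies m≢2 = minimal m (punchIn v') ι-injective
    (ℕP.≤∧≢⇒< (ℕP.≤-pred 3≤n) (m≢2 ∘ sym)) (ℕP.n<1+n m)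

  hub? : Dec (∃ λ u₁ → InW u₁ × Hub u₁)
  hub? = FinP.any? λ u₁ → (¬? (u₁ FinP.≟ v) ×-dec ¬? (u₁ FinP.≟ v')) ×-dec
           FinP.all? λ w → (¬? (w FinP.≟ v) ×-dec ¬? (w FinP.≟ v')) →-dec
                           (¬? (w FinP.≟ u₁) →-dec (d u₁ w ≟ℝ 2ℝ))

  satisfies : suc m ≤ ℓ* R d + up R d
  satisfies with a ≟ℝ 2ℝ | m ℕP.≟ 2
  ... | yes a≡2 | yes refl = ℕP.≤-trans (three-universal-pairs a≡2 u∈W (only-u refl)) (ℕP.m≤n+m _ _)
  ... | yes a≡2 | no m≢2 = twin-distance-2 a≡2 (subspace-satisfies m≢2)
  ... | no a≢2 | _ with hub?
  ...   | yes (u₁ , u₁∈W , hub) = HubCount.hub-count a≢2 u₁∈W hub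
  ...   | no noHub = no-hub a≢2 noHub u∈W (subspace-satisfies λ m≡2 →
            noHub (u , u∈W , λ w w∈W w≢u → ⊥-elim (w≢u (only-u m≡2 w∈W))))

proposition2 : (R : RealNumbers) → let open RealNumbers R in
    (n : ℕ) (d : Fin n → Fin n → ℝ) → IsMetric R d → 3 ≤ n →
    ℓ* R d + up R d < n →
    ProperSubspacesSatisfy R d →
    (v v' : Fin n) → Twins R d v v' →
    ∃ λ u → u ≢ v × u ≢ v' × d v u ≢ 1ℝ
proposition2 R (suc m) d M 3≤n counterexample minimal v v' twins
  with FinP.any? (λ u → ¬? (u FinP.≟ v) ×-dec ¬? (u FinP.≟ v') ×-dec
                         ¬? (RealNumbers._≟ℝ_ R (d v u) (RealNumbers.1ℝ R)))
... | yes witness = witness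
... | no none = ⊥-elim (ℕP.<⇒≱ counterexample (unit-twins-satisfy R d M 3≤n minimal v v' twins unit))
  where
  open RealNumbers R
  unit : ∀ u → u ≢ v → u ≢ v' → d v u ≡ 1ℝ
  unit u u≢v u≢v' = decidable-stable (d v u ≟ℝ 1ℝ) λ d≢1 → none (u , u≢v , u≢v' , d≢1)
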